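{- Let $L\ge 1$ and $N=2^L$. Set \[ S_L=\{\,0\le p<L:\ p\not\equiv 2,5 \pmod 6\,\}. \] Then the signed generating polynomial \[ F_L(x)=\sum_{n=0}^{N-1} (-1)^{\mathcal{M}_2(n)}x^n \] admits the factorization \[ F_L(x)=\prod_{p\in S_L}(1-x^{2^p})\prod_{0\le p<L,\ p\notin S_L}(1+x^{2^p}). \] Hence $(1-x)^{|S_L|}\mid F_L(x)$, and the partition of $\{0,1,\dots,N-1\}$ induced by $\mathcal{M}_2$ is PTE of degree $|S_L|-1$. In particular, if $L=6q+r$ with $0\le r<6$, then \[ |S_L|=L-\bigl(2q+\mathbf 1_{r\in\{3,4,5\}}\bigr), \] so the degree is \[ L-\bigl(2q+\mathbf 1_{r\in\{3,4,5\}}\bigr)-1. \]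
   Context: Write $b_p(n)=\lfloor n/2^p\rfloor\bmod 2$ for the binary digits of $n$, and let $t(n)=s_2(n)\bmod 2$ be the Thue--Morse sequence (parity of the binary digit sum). The meta-Thue--Morse sequence $\mathcal{M}_2$ (OEIS A391614) is defined by $\mathcal{M}_2(4n)=\mathcal{M}_2(2n+\mathcal{M}_2(n))$, $\mathcal{M}_2(4n+2)=\mathcal{M}_2(2n+1-\mathcal{M}_2(n))$, $\mathcal{M}_2(2n+1)=1-\mathcal{M}_2(2n)$, $\mathcal{M}_2(0)=0$. It admits the closed form $\mathcal{M}_2(n)=t(q(n))$, where $q(n)$ is obtained from $n$ by setting to $0$ all binary digits in positions $p\equiv 2,5\pmod 6$. A partition of a finite set into two classes is PTE (Prouhet--Tarry--Escott) of degree $D$ if the two classes have equal sums of $k$-th powers for $k=0,1,\dots,D$. $\mathbf 1_{(\cdot)}$ is the indicator function. -}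

module Defs where

open import Data.Nat as ℕ using (ℕ; zero; suc; _∸_; _≤_; _<_)
open import Data.Nat.DivMod using (_/_; _%_)
open import Data.Bool using (Bool; true; false; not; _∨_; if_then_else_)
open import Data.List using (List; []; _∷_; map; foldr; upTo; filterᵇ; length; replicate; _++_)
open import Data.Nat.ListAction using (sum)
open import Data.Integer as ℤ using (ℤ; +_; -_)
open import Relation.Binary.PropositionalEquality using (_≡_)

-- M₂ defined by its recursion
--   M₂(0) = 0, M₂(4n) = M₂(2n + M₂(n)), M₂(4n+2) = M₂(2n+1 − M₂(n)),
--   M₂(2n+1) = 1 − M₂(2n).
-- Every recursive call is on a strictly smaller argument, so the fuel
-- n+1 used in M₂ below is always sufficient; the fuel is only a device to
-- make the recursion structural.
M₂-go : ℕ → ℕ → ℕ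
M₂-go zero    n = 0
M₂-go (suc f) zero = 0
M₂-go (suc f) (suc n) with (suc n) % 2 | (suc n) % 4
... | 1 | _ = 1 ∸ M₂-go f n
... | _ | 0 = M₂-go f (2 ℕ.* (suc n / 4) ℕ.+ M₂-go f (suc n / 4))
... | _ | _ = M₂-go f ((2 ℕ.* (suc n / 4) ℕ.+ 1) ∸ M₂-go f (suc n / 4))

M₂ : ℕ → ℕ
M₂ n = M₂-go (suc n) n

inSᵇ : ℕ → Bool
inSᵇ p = not (((p % 6) ℕ.≡ᵇ 2) ∨ ((p % 6) ℕ.≡ᵇ 5))

S : ℕ → List ℕ
S L = filterᵇ inSᵇ (upTo L)

notS : ℕ → List ℕ
notS L = filterᵇ (λ p → not (inSᵇ p)) (upTo L)

-- Integer polynomials as coefficient lists (constant term first)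

Poly : Set
Poly = List ℤ

coeff : Poly → ℕ → ℤ
coeff []      k       = + 0
coeff (a ∷ p) zero    = a
coeff (a ∷ p) (suc k) = coeff p k

_≈P_ : Poly → Poly → Set
P ≈P Q = ∀ k → coeff P k ≡ coeff Q k

infix 4 _≈P_
infixl 6 _+P_ _-P_
infixl 7 _*P_
infixr 8 _^P_
infix 4 _∣P_

_+P_ : Poly → Poly → Poly
[]      +P q       = q
(a ∷ p) +P []      = a ∷ p
(a ∷ p) +P (b ∷ q) = (a ℤ.+ b) ∷ (p +P q)

negP : Poly → Poly
negP = map -_

_-P_ : Poly → Poly → Poly
p -P q = p +P negP q

_*P_ : Poly → Poly → Poly
[]      *P q = []
(a ∷ p) *P q = map (a ℤ.*_) q +P (+ 0 ∷ (p *P q))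

oneP : Poly
oneP = + 1 ∷ []

X^ : ℕ → Poly
X^ k = replicate k (+ 0) ++ (+ 1 ∷ [])

_^P_ : Poly → ℕ → Poly
p ^P zero  = oneP
p ^P suc n = p *P (p ^P n)

prodP : List Poly → Poly
prodP = foldr _*P_ oneP

_∣P_ : Poly → Poly → Set
P ∣P Q = Σ Poly (λ R → Q ≈P P *P R)
  where open import Data.Product using (Σ)

F : ℕ → Poly
F L = map (λ n → (- (+ 1)) ℤ.^ M₂ n) (upTo (2 ℕ.^ L))

powerSum : ℕ → List ℕ → ℕ
powerSum k A = sum (map (λ n → n ℕ.^ k) A)

IsPTE : ℕ → List ℕ → List ℕ → Set
IsPTE D A B = ∀ k → k ≤ D → powerSum k A ≡ powerSum k B

class0 class1 : ℕ → List ℕ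
class0 N = filterᵇ (λ n → M₂ n ℕ.≡ᵇ 0) (upTo N)
class1 N = filterᵇ (λ n → not (M₂ n ℕ.≡ᵇ 0)) (upTo N)

ind345 : ℕ → ℕ
ind345 r = if (r ℕ.≡ᵇ 3) ∨ (r ℕ.≡ᵇ 4) ∨ (r ℕ.≡ᵇ 5) then 1 else 0

module Submission where

-- The closed form of M₂ amounts to M₂ (2^L + n) = M₂ n xor [L ∈ S] for n < 2^L.  This is derived
-- directly from the recursion by induction on L: the recursion expresses the translation by 2^(L+2)
-- through those by 2^(L+1) and 2^L, and the indicator of S obeys the matching rule
-- [L+2 ∈ S] = [L+1 ∈ S] xor [L ∈ S].  Hence F (L+1) = F L · (1 ∓ x^(2^L)), which yields the product
-- formula, and 1 − x^(2^p) = (1 − x)(1 + x + ⋯ + x^(2^p − 1)) yields the divisibility.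
-- The PTE property is Prouhet's argument on power sums over [0, 2N) split into two halves: if the
-- second half repeats the colouring of the first, equal power sums of exponents < K persist; if it
-- swaps the colours, the expansion (N + i)^(k+1) = i^(k+1) + (terms of degree ≤ k) gains one exponent.

open import Defs
open import Data.Nat using (ℕ; zero; suc; _+_; _*_; _∸_; _^_; _≤_; _<_; z≤n; s≤s; _≡ᵇ_)
open import Data.Nat.Properties
open import Data.Nat.DivMod
open import Data.Nat.Divisibility using (divides)
open import Data.Nat.Tactic.RingSolver using (solve-∀)
open import Data.Bool using (Bool; true; false; not; _xor_; if_then_else_)
open import Data.Bool.Properties using (not-involutive)
open import Data.Integer as ℤ using (ℤ; +_; -_)
import Data.Integer.Properties as ℤ
open import Data.List using ([]; _∷_; [_]; _++_; map; replicate; length; upTo; applyUpTo; filterᵇ)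
open import Data.List.Properties
  using (upTo-∷ʳ; filter-++; ++-identityʳ; map-++; map-upTo; map-applyUpTo; length-map; length-upTo; length-++)
open import Data.Product using (_×_; _,_)
open import Data.Nat.ListAction using (sum)
open import Relation.Nullary.Decidable using (T?)
open import Function using (_∘_)
open import Algebra.Bundles using (CommutativeMonoid)
open import Algebra.Structures.Biased using (isCommutativeMonoidˡ)
open import Relation.Binary.Bundles using (Setoid)
open import Relation.Binary.Structures using (IsEquivalence)
import Relation.Binary.Reasoning.Setoid
open import Relation.Binary.PropositionalEquality using (_≡_; refl; sym; trans; cong; cong₂; subst; module ≡-Reasoning)


-- The recursion of M₂

data Residue4 : ℕ → Set where
  rem0 : ∀ q → Residue4 (4 * q)
  rem1 : ∀ q → Residue4 (1 + 4 * q)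
  rem2 : ∀ q → Residue4 (2 + 4 * q)
  rem3 : ∀ q → Residue4 (3 + 4 * q)

residue4 : ∀ n → Residue4 n
residue4 zero = rem0 0
residue4 (suc n) with residue4 n
... | rem0 q = rem1 q
... | rem1 q = rem2 q
... | rem2 q = rem3 q
... | rem3 q = subst Residue4 (4*[1+q] q) (rem0 (suc q))
  where
  4*[1+q] : ∀ q → 4 * suc q ≡ 4 + 4 * q
  4*[1+q] = solve-∀

[m+2n]%2≡m%2 : ∀ m n → (m + 2 * n) % 2 ≡ m % 2
[m+2n]%2≡m%2 m n = trans (cong (λ k → (m + k) % 2) (*-comm 2 n)) ([m+kn]%n≡m%n m n 2)

[m+4q]%2≡m%2 : ∀ m q → (m + 4 * q) % 2 ≡ m % 2
[m+4q]%2≡m%2 m q = trans (cong (λ k → (m + k) % 2) (4q≡2[2q] q)) ([m+2n]%2≡m%2 m (2 * q))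
  where
  4q≡2[2q] : ∀ q → 4 * q ≡ 2 * (2 * q)
  4q≡2[2q] = solve-∀

[m+4q]%4≡m%4 : ∀ m q → (m + 4 * q) % 4 ≡ m % 4
[m+4q]%4≡m%4 m q = trans (cong (λ k → (m + k) % 4) (*-comm 4 q)) ([m+kn]%n≡m%n m q 4)

[m+4q]/4≡m/4+q : ∀ m q → (m + 4 * q) / 4 ≡ m / 4 + q
[m+4q]/4≡m/4+q m q = begin
  (m + 4 * q) / 4     ≡⟨ +-distrib-/-∣ʳ m (divides q (*-comm 4 q)) ⟩
  m / 4 + 4 * q / 4   ≡⟨ cong (λ k → m / 4 + k / 4) (*-comm 4 q) ⟩
  m / 4 + q * 4 / 4   ≡⟨ cong (λ k → m / 4 + k) (m*n/n≡m q 4) ⟩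
  m / 4 + q           ∎
  where open ≡-Reasoning

M₂-go-≤1 : ∀ f n → M₂-go f n ≤ 1
M₂-go-≤1 zero n = z≤n
M₂-go-≤1 (suc f) zero = z≤n
M₂-go-≤1 (suc f) (suc n) with suc n % 2 | suc n % 4
... | 1 | _ = m∸n≤m 1 (M₂-go f n)
... | zero | zero = M₂-go-≤1 f _
... | zero | suc _ = M₂-go-≤1 f _
... | suc (suc _) | zero = M₂-go-≤1 f _
... | suc (suc _) | suc _ = M₂-go-≤1 f _

M₂-go-odd : ∀ f n → suc n % 2 ≡ 1 → M₂-go (suc f) (suc n) ≡ 1 ∸ M₂-go f n
M₂-go-odd f n e rewrite e = refl

M₂-go-4q : ∀ f q → M₂-go (suc f) (4 * suc q) ≡ M₂-go f (2 * suc q + M₂-go f (suc q))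
M₂-go-4q f q
  rewrite [m+4q]%2≡m%2 0 (suc q) | [m+4q]%4≡m%4 0 (suc q) | [m+4q]/4≡m/4+q 0 (suc q) = refl

M₂-go-2+4q : ∀ f q → M₂-go (suc f) (2 + 4 * q) ≡ M₂-go f ((2 * q + 1) ∸ M₂-go f q)
M₂-go-2+4q f q
  rewrite [m+4q]%2≡m%2 2 q | [m+4q]%4≡m%4 2 q | [m+4q]/4≡m/4+q 2 q = refl

m+k≡n⇒m≤n : ∀ {m n} k → m + k ≡ n → m ≤ n
m+k≡n⇒m≤n {m} k e = subst (m ≤_) e (m≤m+n m k)

1+q<4[1+q] : ∀ q → suc q < 4 * suc q
1+q<4[1+q] q = m+k≡n⇒m≤n (2 + 3 * q) (e q)
  where
  e : ∀ q → suc (suc q) + (2 + 3 * q) ≡ 4 * suc q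
  e = solve-∀

2[1+q]+v<4[1+q] : ∀ q {v} → v ≤ 1 → 2 * suc q + v < 4 * suc q
2[1+q]+v<4[1+q] q v≤1 = ≤-trans (s≤s (+-monoʳ-≤ (2 * suc q) v≤1)) (m+k≡n⇒m≤n (2 * q) (e q))
  where
  e : ∀ q → suc (2 * suc q + 1) + 2 * q ≡ 4 * suc q
  e = solve-∀

q<2+4q : ∀ q → q < 2 + 4 * q
q<2+4q q = m+k≡n⇒m≤n (1 + 3 * q) (e q)
  where
  e : ∀ q → suc q + (1 + 3 * q) ≡ 2 + 4 * q
  e = solve-∀

[2q+1]∸v<2+4q : ∀ q v → (2 * q + 1) ∸ v < 2 + 4 * q
[2q+1]∸v<2+4q q v = s≤s (≤-trans (m∸n≤m (2 * q + 1) v) (m+k≡n⇒m≤n (2 * q) (e q)))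
  where
  e : ∀ q → 2 * q + 1 + 2 * q ≡ 1 + 4 * q
  e = solve-∀

M₂-go-fuel : ∀ {f g} n → n < f → n < g → M₂-go f n ≡ M₂-go g n
M₂-go-fuel {suc f} {suc g} n (s≤s n≤f) (s≤s n≤g) with residue4 n
... | rem0 zero = refl
... | rem0 (suc q) = begin
  M₂-go (suc f) (4 * suc q)              ≡⟨ M₂-go-4q f q ⟩
  M₂-go f (2 * suc q + M₂-go f (suc q))  ≡⟨ cong (λ v → M₂-go f (2 * suc q + v)) (ih (suc q) (1+q<4[1+q] q)) ⟩
  M₂-go f (2 * suc q + M₂-go g (suc q))  ≡⟨ ih _ (2[1+q]+v<4[1+q] q (M₂-go-≤1 g (suc q))) ⟩
  M₂-go g (2 * suc q + M₂-go g (suc q))  ≡⟨ M₂-go-4q g q ⟨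
  M₂-go (suc g) (4 * suc q)              ∎
  where
  open ≡-Reasoning
  ih : ∀ m → m < 4 * suc q → M₂-go f m ≡ M₂-go g m
  ih m m<n = M₂-go-fuel m (<-≤-trans m<n n≤f) (<-≤-trans m<n n≤g)
... | rem2 q = begin
  M₂-go (suc f) (2 + 4 * q)              ≡⟨ M₂-go-2+4q f q ⟩
  M₂-go f ((2 * q + 1) ∸ M₂-go f q)      ≡⟨ cong (λ v → M₂-go f ((2 * q + 1) ∸ v)) (ih q (q<2+4q q)) ⟩
  M₂-go f ((2 * q + 1) ∸ M₂-go g q)      ≡⟨ ih _ ([2q+1]∸v<2+4q q (M₂-go g q)) ⟩
  M₂-go g ((2 * q + 1) ∸ M₂-go g q)      ≡⟨ M₂-go-2+4q g q ⟨
  M₂-go (suc g) (2 + 4 * q)              ∎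
  where
  open ≡-Reasoning
  ih : ∀ m → m < 2 + 4 * q → M₂-go f m ≡ M₂-go g m
  ih m m<n = M₂-go-fuel m (<-≤-trans m<n n≤f) (<-≤-trans m<n n≤g)
... | rem1 q rewrite [m+4q]%2≡m%2 1 q = cong (1 ∸_) (M₂-go-fuel (4 * q) n≤f n≤g)
... | rem3 q rewrite [m+4q]%2≡m%2 3 q = cong (1 ∸_) (M₂-go-fuel (2 + 4 * q) n≤f n≤g)

M₂≤1 : ∀ n → M₂ n ≤ 1
M₂≤1 n = M₂-go-≤1 (suc n) n

M₂-go≡M₂ : ∀ {f} n → n < f → M₂-go f n ≡ M₂ n
M₂-go≡M₂ n n<f = M₂-go-fuel n n<f ≤-refl

M₂-odd : ∀ n → suc n % 2 ≡ 1 → M₂ (suc n) ≡ 1 ∸ M₂ n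
M₂-odd n = M₂-go-odd (suc n) n

M₂-4n : ∀ n → M₂ (4 * n) ≡ M₂ (2 * n + M₂ n)
M₂-4n zero = refl
M₂-4n (suc q) = begin
  M₂-go (suc (4 * suc q)) (4 * suc q)                    ≡⟨ M₂-go-4q (4 * suc q) q ⟩
  M₂-go (4 * suc q) (2 * suc q + M₂-go (4 * suc q) (suc q))
    ≡⟨ cong (λ v → M₂-go (4 * suc q) (2 * suc q + v)) (M₂-go≡M₂ (suc q) (1+q<4[1+q] q)) ⟩
  M₂-go (4 * suc q) (2 * suc q + M₂ (suc q))             ≡⟨ M₂-go≡M₂ _ (2[1+q]+v<4[1+q] q (M₂≤1 (suc q))) ⟩
  M₂ (2 * suc q + M₂ (suc q))                            ∎
  where open ≡-Reasoning

M₂-2+4n : ∀ n → M₂ (2 + 4 * n) ≡ M₂ ((2 * n + 1) ∸ M₂ n)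
M₂-2+4n q = begin
  M₂-go (3 + 4 * q) (2 + 4 * q)                          ≡⟨ M₂-go-2+4q (2 + 4 * q) q ⟩
  M₂-go (2 + 4 * q) ((2 * q + 1) ∸ M₂-go (2 + 4 * q) q)
    ≡⟨ cong (λ v → M₂-go (2 + 4 * q) ((2 * q + 1) ∸ v)) (M₂-go≡M₂ q (q<2+4q q)) ⟩
  M₂-go (2 + 4 * q) ((2 * q + 1) ∸ M₂ q)                 ≡⟨ M₂-go≡M₂ _ ([2q+1]∸v<2+4q q (M₂ q)) ⟩
  M₂ ((2 * q + 1) ∸ M₂ q)                                ∎
  where open ≡-Reasoning

inSᵇ-6+ : ∀ p → inSᵇ (6 + p) ≡ inSᵇ p
inSᵇ-6+ p rewrite trans (cong (_% 6) (+-comm 6 p)) ([m+n]%n≡m%n p 6) = refl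

inSᵇ-2+ : ∀ p → inSᵇ (2 + p) ≡ inSᵇ (1 + p) xor inSᵇ p
inSᵇ-2+ 0 = refl
inSᵇ-2+ 1 = refl
inSᵇ-2+ 2 = refl
inSᵇ-2+ 3 = refl
inSᵇ-2+ 4 = refl
inSᵇ-2+ 5 = refl
inSᵇ-2+ (suc (suc (suc (suc (suc (suc p)))))) = begin
  inSᵇ (2 + (6 + p))                       ≡⟨ inSᵇ-6+ (2 + p) ⟩
  inSᵇ (2 + p)                             ≡⟨ inSᵇ-2+ p ⟩
  inSᵇ (1 + p) xor inSᵇ p                  ≡⟨ cong₂ _xor_ (inSᵇ-6+ (1 + p)) (inSᵇ-6+ p) ⟨
  inSᵇ (1 + (6 + p)) xor inSᵇ (6 + p)      ∎
  where open ≡-Reasoning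

filterᵇ-upTo-accept : ∀ f n → f n ≡ true → filterᵇ f (upTo (suc n)) ≡ filterᵇ f (upTo n) ++ [ n ]
filterᵇ-upTo-accept f n fn = begin
  filterᵇ f (upTo (suc n))                 ≡⟨ cong (filterᵇ f) (upTo-∷ʳ n) ⟨
  filterᵇ f (upTo n ++ [ n ])              ≡⟨ filter-++ (T? ∘ f) (upTo n) [ n ] ⟩
  filterᵇ f (upTo n) ++ filterᵇ f [ n ]    ≡⟨ cong (λ xs → filterᵇ f (upTo n) ++ xs) accept ⟩
  filterᵇ f (upTo n) ++ [ n ]              ∎
  where
  open ≡-Reasoning
  accept : filterᵇ f [ n ] ≡ [ n ]
  accept rewrite fn = refl

filterᵇ-upTo-reject : ∀ f n → f n ≡ false → filterᵇ f (upTo (suc n)) ≡ filterᵇ f (upTo n)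
filterᵇ-upTo-reject f n fn = begin
  filterᵇ f (upTo (suc n))                 ≡⟨ cong (filterᵇ f) (upTo-∷ʳ n) ⟨
  filterᵇ f (upTo n ++ [ n ])              ≡⟨ filter-++ (T? ∘ f) (upTo n) [ n ] ⟩
  filterᵇ f (upTo n) ++ filterᵇ f [ n ]    ≡⟨ cong (λ xs → filterᵇ f (upTo n) ++ xs) reject ⟩
  filterᵇ f (upTo n) ++ []                 ≡⟨ ++-identityʳ _ ⟩
  filterᵇ f (upTo n)                       ∎
  where
  open ≡-Reasoning
  reject : filterᵇ f [ n ] ≡ []
  reject rewrite fn = refl

length-S-accept : ∀ L → inSᵇ L ≡ true → length (S (suc L)) ≡ suc (length (S L))
length-S-accept L inS = begin
  length (S (suc L))        ≡⟨ cong length (filterᵇ-upTo-accept inSᵇ L inS) ⟩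
  length (S L ++ [ L ])     ≡⟨ length-++ (S L) ⟩
  length (S L) + 1          ≡⟨ +-comm (length (S L)) 1 ⟩
  suc (length (S L))        ∎
  where open ≡-Reasoning

length-S-reject : ∀ L → inSᵇ L ≡ false → length (S (suc L)) ≡ length (S L)
length-S-reject L inS = cong length (filterᵇ-upTo-reject inSᵇ L inS)

length-S-6+ : ∀ p → length (S (6 + p)) ≡ 4 + length (S p)
length-S-6+ zero = refl
length-S-6+ (suc p) with inSᵇ p in inS
... | true = begin
  length (S (suc (6 + p)))    ≡⟨ length-S-accept (6 + p) (trans (inSᵇ-6+ p) inS) ⟩
  suc (length (S (6 + p)))    ≡⟨ cong suc (length-S-6+ p) ⟩
  suc (4 + length (S p))      ≡⟨ cong (λ x → 4 + x) (length-S-accept p inS) ⟨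
  4 + length (S (suc p))      ∎
  where open ≡-Reasoning
... | false = begin
  length (S (suc (6 + p)))    ≡⟨ length-S-reject (6 + p) (trans (inSᵇ-6+ p) inS) ⟩
  length (S (6 + p))          ≡⟨ length-S-6+ p ⟩
  4 + length (S p)            ≡⟨ cong (λ x → 4 + x) (length-S-reject p inS) ⟨
  4 + length (S (suc p))      ∎
  where open ≡-Reasoning

length-S-6q+r : ∀ q r → length (S (6 * q + r)) ≡ 4 * q + length (S r)
length-S-6q+r zero    r = refl
length-S-6q+r (suc q) r = begin
  length (S (6 * suc q + r))      ≡⟨ cong (length ∘ S) (e₁ q r) ⟩
  length (S (6 + (6 * q + r)))    ≡⟨ length-S-6+ (6 * q + r) ⟩
  4 + length (S (6 * q + r))      ≡⟨ cong (λ x → 4 + x) (length-S-6q+r q r) ⟩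
  4 + (4 * q + length (S r))      ≡⟨ e₂ q (length (S r)) ⟩
  4 * suc q + length (S r)        ∎
  where
  open ≡-Reasoning
  e₁ : ∀ q r → 6 * suc q + r ≡ 6 + (6 * q + r)
  e₁ = solve-∀
  e₂ : ∀ q s → 4 + (4 * q + s) ≡ 4 * suc q + s
  e₂ = solve-∀

length-S : ∀ q r → r < 6 → length (S (6 * q + r)) ≡ (6 * q + r) ∸ (2 * q + ind345 r)
length-S q r r<6 = trans (length-S-6q+r q r) (residue r r<6)
  where
  4q+s≡[6q+s+i]∸[2q+i] : ∀ s i → 4 * q + s ≡ (6 * q + (s + i)) ∸ (2 * q + i)
  4q+s≡[6q+s+i]∸[2q+i] s i = sym (trans (cong (_∸ (2 * q + i)) (e q s i)) (m+n∸n≡m (4 * q + s) (2 * q + i)))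
    where
    e : ∀ q s i → 6 * q + (s + i) ≡ (4 * q + s) + (2 * q + i)
    e = solve-∀
  -- r = s + i with s = |S r| and i = 1_{r ∈ {3,4,5}}
  residue : ∀ r → r < 6 → 4 * q + length (S r) ≡ (6 * q + r) ∸ (2 * q + ind345 r)
  residue 0 _ = 4q+s≡[6q+s+i]∸[2q+i] 0 0
  residue 1 _ = 4q+s≡[6q+s+i]∸[2q+i] 1 0
  residue 2 _ = 4q+s≡[6q+s+i]∸[2q+i] 2 0
  residue 3 _ = 4q+s≡[6q+s+i]∸[2q+i] 2 1
  residue 4 _ = 4q+s≡[6q+s+i]∸[2q+i] 3 1
  residue 5 _ = 4q+s≡[6q+s+i]∸[2q+i] 4 1
  residue (suc (suc (suc (suc (suc (suc r)))))) (s≤s (s≤s (s≤s (s≤s (s≤s (s≤s ()))))))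

-- Translation by a power of two

1∸[1∸v]≡v : ∀ {v} → v ≤ 1 → 1 ∸ (1 ∸ v) ≡ v
1∸[1∸v]≡v z≤n = refl
1∸[1∸v]≡v (s≤s z≤n) = refl

toggle : Bool → ℕ → ℕ
toggle b v = if b then 1 ∸ v else v

toggle-≤1 : ∀ b {v} → v ≤ 1 → toggle b v ≤ 1
toggle-≤1 false v≤1 = v≤1
toggle-≤1 true  {v} _ = m∸n≤m 1 v

toggle-toggle : ∀ a b {v} → v ≤ 1 → toggle a (toggle b v) ≡ toggle (a xor b) v
toggle-toggle false b     _   = refl
toggle-toggle true  false _   = refl
toggle-toggle true  true  v≤1 = 1∸[1∸v]≡v v≤1

1∸toggle : ∀ b v → 1 ∸ toggle b v ≡ toggle b (1 ∸ v)
1∸toggle false v = refl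
1∸toggle true  v = refl

M₂-2n+toggle : ∀ n b {v} → v ≤ 1 → M₂ (2 * n + toggle b v) ≡ toggle b (M₂ (2 * n + v))
M₂-2n+toggle n false _ = refl
M₂-2n+toggle n true z≤n = begin
  M₂ (2 * n + 1)      ≡⟨ cong M₂ (+-comm (2 * n) 1) ⟩
  M₂ (suc (2 * n))    ≡⟨ M₂-odd (2 * n) ([m+2n]%2≡m%2 1 n) ⟩
  1 ∸ M₂ (2 * n)      ≡⟨ cong (λ m → 1 ∸ M₂ m) (+-identityʳ (2 * n)) ⟨
  1 ∸ M₂ (2 * n + 0)  ∎
  where open ≡-Reasoning
M₂-2n+toggle n true (s≤s z≤n) = begin
  M₂ (2 * n + 0)            ≡⟨ cong M₂ (+-identityʳ (2 * n)) ⟩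
  M₂ (2 * n)                ≡⟨ 1∸[1∸v]≡v (M₂≤1 (2 * n)) ⟨
  1 ∸ (1 ∸ M₂ (2 * n))      ≡⟨ cong (1 ∸_) (M₂-odd (2 * n) ([m+2n]%2≡m%2 1 n)) ⟨
  1 ∸ M₂ (suc (2 * n))      ≡⟨ cong (λ m → 1 ∸ M₂ m) (+-comm 1 (2 * n)) ⟩
  1 ∸ M₂ (2 * n + 1)        ∎
  where open ≡-Reasoning

2m+v<2n : ∀ {m n v} → m < n → v ≤ 1 → 2 * m + v < 2 * n
2m+v<2n {m} {n} m<n v≤1 = ≤-trans (s≤s (+-monoʳ-≤ (2 * m) v≤1)) (subst (_≤ 2 * n) (e m) (*-monoʳ-≤ 2 m<n))
  where
  e : ∀ m → 2 * suc m ≡ suc (2 * m + 1)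
  e = solve-∀

r+4q<4P⇒q<P : ∀ r q P → r + 4 * q < 2 * (2 * P) → q < P
r+4q<4P⇒q<P r q P h = *-cancelˡ-< 4 q P (≤-<-trans (m≤n+m (4 * q) r) (subst (r + 4 * q <_) (e P) h))
  where
  e : ∀ P → 2 * (2 * P) ≡ 4 * P
  e = solve-∀

M₂-shift-suc : ∀ R s m → suc m % 2 ≡ 1 →
               M₂ (2 * R + m) ≡ toggle s (M₂ m) → M₂ (2 * R + suc m) ≡ toggle s (M₂ (suc m))
M₂-shift-suc R s m odd shift = begin
  M₂ (2 * R + suc m)     ≡⟨ cong M₂ (+-suc (2 * R) m) ⟩
  M₂ (suc (2 * R + m))   ≡⟨ M₂-odd (2 * R + m) odd′ ⟩
  1 ∸ M₂ (2 * R + m)     ≡⟨ cong (1 ∸_) shift ⟩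
  1 ∸ toggle s (M₂ m)    ≡⟨ 1∸toggle s (M₂ m) ⟩
  toggle s (1 ∸ M₂ m)    ≡⟨ cong (toggle s) (M₂-odd m odd) ⟨
  toggle s (M₂ (suc m))  ∎
  where
  open ≡-Reasoning
  odd′ : suc (2 * R + m) % 2 ≡ 1
  odd′ = trans (cong (λ k → suc k % 2) (+-comm (2 * R) m)) (trans ([m+2n]%2≡m%2 (suc m) R) odd)

module _ {P : ℕ} {s₀ s₁ : Bool}
  (shift₀ : ∀ n → n < P → M₂ (P + n) ≡ toggle s₀ (M₂ n))
  (shift₁ : ∀ n → n < 2 * P → M₂ (2 * P + n) ≡ toggle s₁ (M₂ n)) where

  open ≡-Reasoning

  private
    shift-2n+v : ∀ q {v} → q < P → v ≤ 1 →
                 M₂ (2 * (P + q) + toggle s₀ v) ≡ toggle (s₁ xor s₀) (M₂ (2 * q + v))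
    shift-2n+v q {v} q<P v≤1 = begin
      M₂ (2 * (P + q) + toggle s₀ v)          ≡⟨ cong M₂ (e P q (toggle s₀ v)) ⟩
      M₂ (2 * P + (2 * q + toggle s₀ v))      ≡⟨ shift₁ _ (2m+v<2n q<P (toggle-≤1 s₀ v≤1)) ⟩
      toggle s₁ (M₂ (2 * q + toggle s₀ v))    ≡⟨ cong (toggle s₁) (M₂-2n+toggle q s₀ v≤1) ⟩
      toggle s₁ (toggle s₀ (M₂ (2 * q + v)))  ≡⟨ toggle-toggle s₁ s₀ (M₂≤1 (2 * q + v)) ⟩
      toggle (s₁ xor s₀) (M₂ (2 * q + v))     ∎
      where
      e : ∀ P q w → 2 * (P + q) + w ≡ 2 * P + (2 * q + w)
      e = solve-∀

    shift-4q : ∀ q → q < P → M₂ (2 * (2 * P) + 4 * q) ≡ toggle (s₁ xor s₀) (M₂ (4 * q))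
    shift-4q q q<P = begin
      M₂ (2 * (2 * P) + 4 * q)                ≡⟨ cong M₂ (e P q) ⟩
      M₂ (4 * (P + q))                        ≡⟨ M₂-4n (P + q) ⟩
      M₂ (2 * (P + q) + M₂ (P + q))           ≡⟨ cong (λ v → M₂ (2 * (P + q) + v)) (shift₀ q q<P) ⟩
      M₂ (2 * (P + q) + toggle s₀ (M₂ q))     ≡⟨ shift-2n+v q q<P (M₂≤1 q) ⟩
      toggle (s₁ xor s₀) (M₂ (2 * q + M₂ q))  ≡⟨ cong (toggle (s₁ xor s₀)) (M₂-4n q) ⟨
      toggle (s₁ xor s₀) (M₂ (4 * q))         ∎
      where
      e : ∀ P q → 2 * (2 * P) + 4 * q ≡ 4 * (P + q)
      e = solve-∀

    shift-2+4q : ∀ q → q < P → M₂ (2 * (2 * P) + (2 + 4 * q)) ≡ toggle (s₁ xor s₀) (M₂ (2 + 4 * q))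
    shift-2+4q q q<P = begin
      M₂ (2 * (2 * P) + (2 + 4 * q))
        ≡⟨ cong M₂ (e P q) ⟩
      M₂ (2 + 4 * (P + q))
        ≡⟨ M₂-2+4n (P + q) ⟩
      M₂ ((2 * (P + q) + 1) ∸ M₂ (P + q))
        ≡⟨ cong (λ v → M₂ ((2 * (P + q) + 1) ∸ v)) (shift₀ q q<P) ⟩
      M₂ ((2 * (P + q) + 1) ∸ toggle s₀ (M₂ q))
        ≡⟨ cong M₂ (+-∸-assoc (2 * (P + q)) (toggle-≤1 s₀ (M₂≤1 q))) ⟩
      M₂ (2 * (P + q) + (1 ∸ toggle s₀ (M₂ q)))
        ≡⟨ cong (λ v → M₂ (2 * (P + q) + v)) (1∸toggle s₀ (M₂ q)) ⟩
      M₂ (2 * (P + q) + toggle s₀ (1 ∸ M₂ q))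
        ≡⟨ shift-2n+v q q<P (m∸n≤m 1 (M₂ q)) ⟩
      toggle (s₁ xor s₀) (M₂ (2 * q + (1 ∸ M₂ q)))
        ≡⟨ cong (λ m → toggle (s₁ xor s₀) (M₂ m)) (+-∸-assoc (2 * q) (M₂≤1 q)) ⟨
      toggle (s₁ xor s₀) (M₂ ((2 * q + 1) ∸ M₂ q))
        ≡⟨ cong (toggle (s₁ xor s₀)) (M₂-2+4n q) ⟨
      toggle (s₁ xor s₀) (M₂ (2 + 4 * q))
        ∎
      where
      e : ∀ P q → 2 * (2 * P) + (2 + 4 * q) ≡ 2 + 4 * (P + q)
      e = solve-∀

  M₂-shift-step : ∀ n → n < 2 * (2 * P) → M₂ (2 * (2 * P) + n) ≡ toggle (s₁ xor s₀) (M₂ n)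
  M₂-shift-step n n<4P with residue4 n
  ... | rem0 q = shift-4q q (r+4q<4P⇒q<P 0 q P n<4P)
  ... | rem2 q = shift-2+4q q (r+4q<4P⇒q<P 2 q P n<4P)
  ... | rem1 q = M₂-shift-suc (2 * P) _ (4 * q) ([m+4q]%2≡m%2 1 q)
                   (shift-4q q (r+4q<4P⇒q<P 1 q P n<4P))
  ... | rem3 q = M₂-shift-suc (2 * P) _ (2 + 4 * q) ([m+4q]%2≡m%2 3 q)
                   (shift-2+4q q (r+4q<4P⇒q<P 3 q P n<4P))

M₂-shift : ∀ L n → n < 2 ^ L → M₂ (2 ^ L + n) ≡ toggle (inSᵇ L) (M₂ n)
M₂-shift 0 0 _ = refl
M₂-shift 1 0 _ = refl
M₂-shift 1 1 _ = refl
M₂-shift 0 (suc n) (s≤s ())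
M₂-shift 1 (suc (suc n)) (s≤s (s≤s ()))
M₂-shift (suc (suc L)) n n<4P =
  subst (λ s → M₂ (2 ^ suc (suc L) + n) ≡ toggle s (M₂ n)) (sym (inSᵇ-2+ L))
        (M₂-shift-step (M₂-shift L) (M₂-shift (suc L)) n n<4P)

-- _≈P_ unfolds to a Π-type, from which Agda cannot infer the two polynomials; the record can.
record _≋_ (p q : Poly) : Set where
  constructor coeff-ext
  field coeff-≡ : p ≈P q
open _≋_

infix 4 _≋_

≋-refl : ∀ {p} → p ≋ p
≋-refl = coeff-ext λ _ → refl

≋-sym : ∀ {p q} → p ≋ q → q ≋ p
≋-sym (coeff-ext e) = coeff-ext λ k → sym (e k)

≋-trans : ∀ {p q r} → p ≋ q → q ≋ r → p ≋ r
≋-trans (coeff-ext e) (coeff-ext f) = coeff-ext λ k → trans (e k) (f k)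

≋-isEquivalence : IsEquivalence _≋_
≋-isEquivalence = record { refl = ≋-refl ; sym = ≋-sym ; trans = ≋-trans }

≋-setoid : Setoid _ _
≋-setoid = record { isEquivalence = ≋-isEquivalence }

module ≋-Reasoning = Relation.Binary.Reasoning.Setoid ≋-setoid

∷-cong : ∀ {a b p q} → a ≡ b → p ≋ q → a ∷ p ≋ b ∷ q
∷-cong refl (coeff-ext e) = coeff-ext λ { zero → refl ; (suc k) → e k }

0∷[]≋[] : + 0 ∷ [] ≋ []
0∷[]≋[] = coeff-ext λ { zero → refl ; (suc k) → refl }

coeff-+P : ∀ p q k → coeff (p +P q) k ≡ coeff p k ℤ.+ coeff q k
coeff-+P []      q       k       = sym (ℤ.+-identityˡ _)
coeff-+P (a ∷ p) []      k       = sym (ℤ.+-identityʳ _)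
coeff-+P (a ∷ p) (b ∷ q) zero    = refl
coeff-+P (a ∷ p) (b ∷ q) (suc k) = coeff-+P p q k

coeff-map : ∀ {f} → f (+ 0) ≡ + 0 → ∀ p k → coeff (map f p) k ≡ f (coeff p k)
coeff-map f0 []      k       = sym f0
coeff-map f0 (a ∷ p) zero    = refl
coeff-map f0 (a ∷ p) (suc k) = coeff-map f0 p k

+P-cong : ∀ {p p′ q q′} → p ≋ p′ → q ≋ q′ → p +P q ≋ p′ +P q′
+P-cong {p} {p′} {q} {q′} (coeff-ext e) (coeff-ext f) = coeff-ext λ k → begin
  coeff (p +P q) k              ≡⟨ coeff-+P p q k ⟩
  coeff p k ℤ.+ coeff q k       ≡⟨ cong₂ ℤ._+_ (e k) (f k) ⟩
  coeff p′ k ℤ.+ coeff q′ k     ≡⟨ coeff-+P p′ q′ k ⟨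
  coeff (p′ +P q′) k            ∎
  where open ≡-Reasoning

+P-assoc : ∀ p q r → (p +P q) +P r ≋ p +P (q +P r)
+P-assoc p q r = coeff-ext λ k → begin
  coeff ((p +P q) +P r) k                          ≡⟨ coeff-+P (p +P q) r k ⟩
  coeff (p +P q) k ℤ.+ coeff r k                   ≡⟨ cong (ℤ._+ coeff r k) (coeff-+P p q k) ⟩
  (coeff p k ℤ.+ coeff q k) ℤ.+ coeff r k          ≡⟨ ℤ.+-assoc (coeff p k) (coeff q k) (coeff r k) ⟩
  coeff p k ℤ.+ (coeff q k ℤ.+ coeff r k)          ≡⟨ cong (λ x → coeff p k ℤ.+ x) (coeff-+P q r k) ⟨
  coeff p k ℤ.+ coeff (q +P r) k                   ≡⟨ coeff-+P p (q +P r) k ⟨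
  coeff (p +P (q +P r)) k                          ∎
  where open ≡-Reasoning

+P-comm : ∀ p q → p +P q ≋ q +P p
+P-comm p q = coeff-ext λ k → begin
  coeff (p +P q) k         ≡⟨ coeff-+P p q k ⟩
  coeff p k ℤ.+ coeff q k  ≡⟨ ℤ.+-comm (coeff p k) (coeff q k) ⟩
  coeff q k ℤ.+ coeff p k  ≡⟨ coeff-+P q p k ⟨
  coeff (q +P p) k         ∎
  where open ≡-Reasoning

+P-commutativeMonoid : CommutativeMonoid _ _
+P-commutativeMonoid = record
  { _∙_ = _+P_
  ; ε = []
  ; isCommutativeMonoid = isCommutativeMonoidˡ record
    { isSemigroup = record
      { isMagma = record { isEquivalence = ≋-isEquivalence ; ∙-cong = +P-cong }
      ; assoc = +P-assoc }
    ; identityˡ = λ _ → ≋-refl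
    ; comm = +P-comm } }

open CommutativeMonoid +P-commutativeMonoid
  using () renaming (identityʳ to +P-identityʳ)
open import Algebra.Properties.CommutativeSemigroup (CommutativeMonoid.commutativeSemigroup +P-commutativeMonoid)
  using () renaming (x∙yz≈y∙xz to +P-x∙yz≈y∙xz; interchange to +P-interchange)

infixr 7 _·P_

_·P_ : ℤ → Poly → Poly
a ·P p = map (a ℤ.*_) p

coeff-·P : ∀ a p k → coeff (a ·P p) k ≡ a ℤ.* coeff p k
coeff-·P a = coeff-map (ℤ.*-zeroʳ a)

·P-cong : ∀ a {p q} → p ≋ q → a ·P p ≋ a ·P q
·P-cong a {p} {q} (coeff-ext e) = coeff-ext λ k →
  trans (coeff-·P a p k) (trans (cong (a ℤ.*_) (e k)) (sym (coeff-·P a q k)))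

·P-distrib-+P : ∀ a p q → a ·P (p +P q) ≋ a ·P p +P a ·P q
·P-distrib-+P a p q = coeff-ext λ k → begin
  coeff (a ·P (p +P q)) k                               ≡⟨ coeff-·P a (p +P q) k ⟩
  a ℤ.* coeff (p +P q) k                                ≡⟨ cong (a ℤ.*_) (coeff-+P p q k) ⟩
  a ℤ.* (coeff p k ℤ.+ coeff q k)                       ≡⟨ ℤ.*-distribˡ-+ a (coeff p k) (coeff q k) ⟩
  a ℤ.* coeff p k ℤ.+ a ℤ.* coeff q k                   ≡⟨ cong₂ ℤ._+_ (coeff-·P a p k) (coeff-·P a q k) ⟨
  coeff (a ·P p) k ℤ.+ coeff (a ·P q) k                 ≡⟨ coeff-+P (a ·P p) (a ·P q) k ⟨
  coeff (a ·P p +P a ·P q) k                            ∎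
  where open ≡-Reasoning

+-distrib-·P : ∀ a b p → (a ℤ.+ b) ·P p ≋ a ·P p +P b ·P p
+-distrib-·P a b p = coeff-ext λ k → begin
  coeff ((a ℤ.+ b) ·P p) k                              ≡⟨ coeff-·P (a ℤ.+ b) p k ⟩
  (a ℤ.+ b) ℤ.* coeff p k                               ≡⟨ ℤ.*-distribʳ-+ (coeff p k) a b ⟩
  a ℤ.* coeff p k ℤ.+ b ℤ.* coeff p k                   ≡⟨ cong₂ ℤ._+_ (coeff-·P a p k) (coeff-·P b p k) ⟨
  coeff (a ·P p) k ℤ.+ coeff (b ·P p) k                 ≡⟨ coeff-+P (a ·P p) (b ·P p) k ⟨
  coeff (a ·P p +P b ·P p) k                            ∎
  where open ≡-Reasoning

·P-assoc : ∀ a b p → (a ℤ.* b) ·P p ≋ a ·P b ·P p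
·P-assoc a b p = coeff-ext λ k → begin
  coeff ((a ℤ.* b) ·P p) k     ≡⟨ coeff-·P (a ℤ.* b) p k ⟩
  a ℤ.* b ℤ.* coeff p k        ≡⟨ ℤ.*-assoc a b (coeff p k) ⟩
  a ℤ.* (b ℤ.* coeff p k)      ≡⟨ cong (a ℤ.*_) (coeff-·P b p k) ⟨
  a ℤ.* coeff (b ·P p) k       ≡⟨ coeff-·P a (b ·P p) k ⟨
  coeff (a ·P b ·P p) k        ∎
  where open ≡-Reasoning

0·P : ∀ p → + 0 ·P p ≋ []
0·P p = coeff-ext λ k → coeff-·P (+ 0) p k

1·P : ∀ p → + 1 ·P p ≋ p
1·P p = coeff-ext λ k → trans (coeff-·P (+ 1) p k) (ℤ.*-identityˡ (coeff p k))

negP≋-1·P : ∀ p → negP p ≋ ℤ.-1ℤ ·P p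
negP≋-1·P p = coeff-ext λ k → begin
  coeff (negP p) k             ≡⟨ coeff-map refl p k ⟩
  - coeff p k                  ≡⟨ ℤ.-1*i≡-i (coeff p k) ⟨
  ℤ.-1ℤ ℤ.* coeff p k          ≡⟨ coeff-·P ℤ.-1ℤ p k ⟨
  coeff (ℤ.-1ℤ ·P p) k         ∎
  where open ≡-Reasoning

*P-congʳ : ∀ p {q q′} → q ≋ q′ → p *P q ≋ p *P q′
*P-congʳ []      q≋q′ = ≋-refl
*P-congʳ (a ∷ p) q≋q′ = +P-cong (·P-cong a q≋q′) (∷-cong refl (*P-congʳ p q≋q′))

*P-zeroʳ : ∀ p → p *P [] ≋ []
*P-zeroʳ []      = ≋-refl
*P-zeroʳ (a ∷ p) = ≋-trans (∷-cong refl (*P-zeroʳ p)) 0∷[]≋[]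

0∷-*P : ∀ p q → (+ 0 ∷ p) *P q ≋ + 0 ∷ p *P q
0∷-*P p q = +P-cong (0·P q) ≋-refl

*P-∷ʳ : ∀ p b q → p *P (b ∷ q) ≋ b ·P p +P (+ 0 ∷ p *P q)
*P-∷ʳ []      b q = ≋-sym 0∷[]≋[]
*P-∷ʳ (a ∷ p) b q = ∷-cong (cong (ℤ._+ + 0) (ℤ.*-comm a b)) (begin
  a ·P q +P p *P (b ∷ q)                   ≈⟨ +P-cong ≋-refl (*P-∷ʳ p b q) ⟩
  a ·P q +P (b ·P p +P (+ 0 ∷ p *P q))     ≈⟨ +P-x∙yz≈y∙xz (a ·P q) (b ·P p) _ ⟩
  b ·P p +P (a ·P q +P (+ 0 ∷ p *P q))     ∎)
  where open ≋-Reasoning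

*P-comm : ∀ p q → p *P q ≋ q *P p
*P-comm []      q = ≋-sym (*P-zeroʳ q)
*P-comm (a ∷ p) q = ≋-trans (+P-cong ≋-refl (∷-cong refl (*P-comm p q))) (≋-sym (*P-∷ʳ q a p))

*P-cong : ∀ {p p′ q q′} → p ≋ p′ → q ≋ q′ → p *P q ≋ p′ *P q′
*P-cong {p} {p′} {q} {q′} p≋p′ q≋q′ = begin
  p *P q    ≈⟨ *P-congʳ p q≋q′ ⟩
  p *P q′   ≈⟨ *P-comm p q′ ⟩
  q′ *P p   ≈⟨ *P-congʳ q′ p≋p′ ⟩
  q′ *P p′  ≈⟨ *P-comm q′ p′ ⟩
  p′ *P q′  ∎
  where open ≋-Reasoning

·P-*P : ∀ a p q → (a ·P p) *P q ≋ a ·P (p *P q)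
·P-*P a []      q = ≋-refl
·P-*P a (b ∷ p) q = begin
  (a ℤ.* b) ·P q +P (+ 0 ∷ (a ·P p) *P q)        ≈⟨ +P-cong (·P-assoc a b q) (∷-cong refl (·P-*P a p q)) ⟩
  a ·P b ·P q +P (+ 0 ∷ a ·P (p *P q))           ≈⟨ +P-cong ≋-refl (∷-cong (sym (ℤ.*-zeroʳ a)) ≋-refl) ⟩
  a ·P b ·P q +P a ·P (+ 0 ∷ p *P q)             ≈⟨ ·P-distrib-+P a (b ·P q) _ ⟨
  a ·P (b ·P q +P (+ 0 ∷ p *P q))                ∎
  where open ≋-Reasoning

*P-distribʳ-+P : ∀ p q r → (p +P q) *P r ≋ p *P r +P q *P r
*P-distribʳ-+P []      q       r = ≋-refl
*P-distribʳ-+P (a ∷ p) []      r = ≋-sym (+P-identityʳ _)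
*P-distribʳ-+P (a ∷ p) (b ∷ q) r = begin
  (a ℤ.+ b) ·P r +P (+ 0 ∷ (p +P q) *P r)
    ≈⟨ +P-cong (+-distrib-·P a b r) (∷-cong refl (*P-distribʳ-+P p q r)) ⟩
  (a ·P r +P b ·P r) +P ((+ 0 ∷ p *P r) +P (+ 0 ∷ q *P r))
    ≈⟨ +P-interchange (a ·P r) (b ·P r) _ _ ⟩
  (a ·P r +P (+ 0 ∷ p *P r)) +P (b ·P r +P (+ 0 ∷ q *P r))
    ∎
  where open ≋-Reasoning

*P-assoc : ∀ p q r → (p *P q) *P r ≋ p *P (q *P r)
*P-assoc []      q r = ≋-refl
*P-assoc (a ∷ p) q r = begin
  (a ·P q +P (+ 0 ∷ p *P q)) *P r            ≈⟨ *P-distribʳ-+P (a ·P q) _ r ⟩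
  (a ·P q) *P r +P (+ 0 ∷ p *P q) *P r       ≈⟨ +P-cong (·P-*P a q r) (0∷-*P (p *P q) r) ⟩
  a ·P (q *P r) +P (+ 0 ∷ (p *P q) *P r)     ≈⟨ +P-cong ≋-refl (∷-cong refl (*P-assoc p q r)) ⟩
  a ·P (q *P r) +P (+ 0 ∷ p *P (q *P r))     ∎
  where open ≋-Reasoning

*P-identityˡ : ∀ p → oneP *P p ≋ p
*P-identityˡ p = ≋-trans (+P-cong (1·P p) 0∷[]≋[]) (+P-identityʳ p)

*P-commutativeMonoid : CommutativeMonoid _ _
*P-commutativeMonoid = record
  { _∙_ = _*P_
  ; ε = oneP
  ; isCommutativeMonoid = isCommutativeMonoidˡ record
    { isSemigroup = record
      { isMagma = record { isEquivalence = ≋-isEquivalence ; ∙-cong = *P-cong }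
      ; assoc = *P-assoc }
    ; identityˡ = *P-identityˡ
    ; comm = *P-comm } }

open import Algebra.Properties.CommutativeSemigroup (CommutativeMonoid.commutativeSemigroup *P-commutativeMonoid)
  using () renaming (xy∙z≈xz∙y to *P-xy∙z≈xz∙y; interchange to *P-interchange)

-- The product formula and the factor (1 − x)^|S_L|

shiftP : ℕ → Poly → Poly
shiftP m p = replicate m (+ 0) ++ p

++≋+P-shiftP : ∀ p q → p ++ q ≋ p +P shiftP (length p) q
++≋+P-shiftP []      q = ≋-refl
++≋+P-shiftP (a ∷ p) q = ∷-cong (sym (ℤ.+-identityʳ a)) (++≋+P-shiftP p q)

negIf : Bool → Poly → Poly
negIf false p = p
negIf true  p = negP p

negIf-X^-*P : ∀ s m p → negIf s (X^ m) *P p ≋ shiftP m (negIf s p)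
negIf-X^-*P false zero    p = *P-identityˡ p
negIf-X^-*P true  zero    p = ≋-trans (+P-cong ≋-refl 0∷[]≋[]) (≋-trans (+P-identityʳ _) (≋-sym (negP≋-1·P p)))
negIf-X^-*P false (suc m) p = ≋-trans (0∷-*P (X^ m) p) (∷-cong refl (negIf-X^-*P false m p))
negIf-X^-*P true  (suc m) p = ≋-trans (0∷-*P (negP (X^ m)) p) (∷-cong refl (negIf-X^-*P true m p))

*P-[1+negIf-X^] : ∀ s m p → p *P (oneP +P negIf s (X^ m)) ≋ p +P shiftP m (negIf s p)
*P-[1+negIf-X^] s m p = begin
  p *P (oneP +P negIf s (X^ m))          ≈⟨ *P-comm p _ ⟩
  (oneP +P negIf s (X^ m)) *P p          ≈⟨ *P-distribʳ-+P oneP (negIf s (X^ m)) p ⟩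
  oneP *P p +P negIf s (X^ m) *P p       ≈⟨ +P-cong (*P-identityˡ p) (negIf-X^-*P s m p) ⟩
  p +P shiftP m (negIf s p)              ∎
  where open ≋-Reasoning

applyUpTo-+ : ∀ {A : Set} (f : ℕ → A) m n → applyUpTo f (m + n) ≡ applyUpTo f m ++ applyUpTo (λ i → f (m + i)) n
applyUpTo-+ f zero    n = refl
applyUpTo-+ f (suc m) n = cong (f 0 ∷_) (applyUpTo-+ (f ∘ suc) m n)

applyUpTo-cong : ∀ {A : Set} {f g : ℕ → A} n → (∀ i → i < n → f i ≡ g i) → applyUpTo f n ≡ applyUpTo g n
applyUpTo-cong zero    f≡g = refl
applyUpTo-cong (suc n) f≡g = cong₂ _∷_ (f≡g 0 (s≤s z≤n)) (applyUpTo-cong n (λ i i<n → f≡g (suc i) (s≤s i<n)))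

sign : ℕ → ℤ
sign n = (- (+ 1)) ℤ.^ M₂ n

length-F : ∀ L → length (F L) ≡ 2 ^ L
length-F L = trans (length-map sign (upTo (2 ^ L))) (length-upTo (2 ^ L))

[-1]^[1∸v] : ∀ {v} → v ≤ 1 → (- (+ 1)) ℤ.^ (1 ∸ v) ≡ - ((- (+ 1)) ℤ.^ v)
[-1]^[1∸v] z≤n       = refl
[-1]^[1∸v] (s≤s z≤n) = refl

sign-shift : ∀ L → applyUpTo (λ i → sign (2 ^ L + i)) (2 ^ L) ≡ negIf (inSᵇ L) (F L)
sign-shift L with inSᵇ L | M₂-shift L
... | false | shift = begin
  applyUpTo (λ i → sign (2 ^ L + i)) (2 ^ L)
    ≡⟨ applyUpTo-cong (2 ^ L) (λ i i< → cong ((- (+ 1)) ℤ.^_) (shift i i<)) ⟩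
  applyUpTo sign (2 ^ L)
    ≡⟨ map-upTo sign (2 ^ L) ⟨
  F L
    ∎
  where open ≡-Reasoning
... | true | shift = begin
  applyUpTo (λ i → sign (2 ^ L + i)) (2 ^ L)
    ≡⟨ applyUpTo-cong (2 ^ L) (λ i i< → trans (cong ((- (+ 1)) ℤ.^_) (shift i i<)) ([-1]^[1∸v] (M₂≤1 i))) ⟩
  applyUpTo (λ i → - sign i) (2 ^ L)
    ≡⟨ map-applyUpTo sign -_ (2 ^ L) ⟨
  map -_ (applyUpTo sign (2 ^ L))
    ≡⟨ cong (map -_) (map-upTo sign (2 ^ L)) ⟨
  negP (F L)
    ∎
  where open ≡-Reasoning

F-suc : ∀ L → F (suc L) ≡ F L ++ negIf (inSᵇ L) (F L)
F-suc L = begin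
  F (suc L)
    ≡⟨ map-upTo sign (2 ^ suc L) ⟩
  applyUpTo sign (2 ^ L + (2 ^ L + 0))
    ≡⟨ cong (λ n → applyUpTo sign (2 ^ L + n)) (+-identityʳ (2 ^ L)) ⟩
  applyUpTo sign (2 ^ L + 2 ^ L)
    ≡⟨ applyUpTo-+ sign (2 ^ L) (2 ^ L) ⟩
  applyUpTo sign (2 ^ L) ++ applyUpTo (λ i → sign (2 ^ L + i)) (2 ^ L)
    ≡⟨ cong₂ _++_ (sym (map-upTo sign (2 ^ L))) (sign-shift L) ⟩
  F L ++ negIf (inSᵇ L) (F L)
    ∎
  where open ≡-Reasoning

prodP-∷ʳ : ∀ ps p → prodP (ps ++ [ p ]) ≋ prodP ps *P p
prodP-∷ʳ []       p = *P-comm p oneP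
prodP-∷ʳ (q ∷ ps) p = ≋-trans (*P-cong (≋-refl {q}) (prodP-∷ʳ ps p)) (≋-sym (*P-assoc q (prodP ps) p))

1-X^ 1+X^ : ℕ → Poly
1-X^ p = oneP -P X^ (2 ^ p)
1+X^ p = oneP +P X^ (2 ^ p)

Prod : ℕ → Poly
Prod L = prodP (map 1-X^ (S L)) *P prodP (map 1+X^ (notS L))

Prod-suc : ∀ L → Prod (suc L) ≋ Prod L *P (oneP +P negIf (inSᵇ L) (X^ (2 ^ L)))
Prod-suc L with inSᵇ L in inS
... | true = begin
  prodP (map 1-X^ (S (suc L))) *P prodP (map 1+X^ (notS (suc L)))
    ≡⟨ cong₂ (λ xs ys → prodP (map 1-X^ xs) *P prodP (map 1+X^ ys))
             (filterᵇ-upTo-accept inSᵇ L inS) (filterᵇ-upTo-reject (not ∘ inSᵇ) L (cong not inS)) ⟩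
  prodP (map 1-X^ (S L ++ [ L ])) *P prodP (map 1+X^ (notS L))
    ≡⟨ cong (λ xs → prodP xs *P prodP (map 1+X^ (notS L))) (map-++ 1-X^ (S L) [ L ]) ⟩
  prodP (map 1-X^ (S L) ++ [ 1-X^ L ]) *P prodP (map 1+X^ (notS L))
    ≈⟨ *P-cong (prodP-∷ʳ (map 1-X^ (S L)) (1-X^ L)) (≋-refl {P₊}) ⟩
  (P₋ *P 1-X^ L) *P P₊
    ≈⟨ *P-xy∙z≈xz∙y P₋ (1-X^ L) P₊ ⟩
  Prod L *P 1-X^ L
    ∎
  where
  open ≋-Reasoning
  P₋ = prodP (map 1-X^ (S L))
  P₊ = prodP (map 1+X^ (notS L))
... | false = begin
  prodP (map 1-X^ (S (suc L))) *P prodP (map 1+X^ (notS (suc L)))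
    ≡⟨ cong₂ (λ xs ys → prodP (map 1-X^ xs) *P prodP (map 1+X^ ys))
             (filterᵇ-upTo-reject inSᵇ L inS) (filterᵇ-upTo-accept (not ∘ inSᵇ) L (cong not inS)) ⟩
  prodP (map 1-X^ (S L)) *P prodP (map 1+X^ (notS L ++ [ L ]))
    ≡⟨ cong (λ ys → prodP (map 1-X^ (S L)) *P prodP ys) (map-++ 1+X^ (notS L) [ L ]) ⟩
  prodP (map 1-X^ (S L)) *P prodP (map 1+X^ (notS L) ++ [ 1+X^ L ])
    ≈⟨ *P-cong (≋-refl {P₋}) (prodP-∷ʳ (map 1+X^ (notS L)) (1+X^ L)) ⟩
  P₋ *P (P₊ *P 1+X^ L)
    ≈⟨ *P-assoc P₋ P₊ (1+X^ L) ⟨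
  Prod L *P 1+X^ L
    ∎
  where
  open ≋-Reasoning
  P₋ = prodP (map 1-X^ (S L))
  P₊ = prodP (map 1+X^ (notS L))

F≋Prod : ∀ L → F L ≋ Prod L
F≋Prod zero    = ≋-sym (*P-identityˡ oneP)
F≋Prod (suc L) = begin
  F (suc L)                                         ≡⟨ F-suc L ⟩
  F L ++ negIf s (F L)                              ≈⟨ ++≋+P-shiftP (F L) (negIf s (F L)) ⟩
  F L +P shiftP (length (F L)) (negIf s (F L))      ≡⟨ cong (λ m → F L +P shiftP m (negIf s (F L))) (length-F L) ⟩
  F L +P shiftP (2 ^ L) (negIf s (F L))             ≈⟨ *P-[1+negIf-X^] s (2 ^ L) (F L) ⟨
  F L *P (oneP +P negIf s (X^ (2 ^ L)))             ≈⟨ *P-cong (F≋Prod L) ≋-refl ⟩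
  Prod L *P (oneP +P negIf s (X^ (2 ^ L)))          ≈⟨ Prod-suc L ⟨
  Prod (suc L)                                      ∎
  where
  open ≋-Reasoning
  s = inSᵇ L

geometric : ℕ → Poly
geometric m = replicate m (+ 1)

[1-x]*geometric : ∀ m → (oneP -P X^ 1) *P geometric m ≋ oneP -P X^ m
[1-x]*geometric zero    = ≋-trans (*P-zeroʳ (oneP -P X^ 1)) (≋-sym 0∷[]≋[])
[1-x]*geometric (suc m) = ≋-trans (*P-∷ʳ (oneP -P X^ 1) (+ 1) (geometric m))
  (≋-trans (+P-cong (1·P (oneP -P X^ 1)) (∷-cong {a = + 0} refl ([1-x]*geometric m))) (telescope m))
  where
  telescope : ∀ m → (oneP -P X^ 1) +P (+ 0 ∷ (oneP -P X^ m)) ≋ oneP -P X^ (suc m)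
  telescope zero    = ≋-refl
  telescope (suc m) = ≋-refl

prodP-factor : ∀ d (f g : ℕ → Poly) ps → (∀ p → f p ≋ d *P g p) →
               prodP (map f ps) ≋ d ^P length ps *P prodP (map g ps)
prodP-factor d f g []       _  = ≋-sym (*P-identityˡ oneP)
prodP-factor d f g (p ∷ ps) fg = ≋-trans (*P-cong (fg p) (prodP-factor d f g ps fg))
                                          (*P-interchange d (g p) (d ^P length ps) (prodP (map g ps)))

[1-x]^|S|∣F : ∀ L → (oneP -P X^ 1) ^P length (S L) ∣P F L
[1-x]^|S|∣F L = G *P P₊ , coeff-≡ (begin
  F L                                      ≈⟨ F≋Prod L ⟩
  prodP (map 1-X^ (S L)) *P P₊             ≈⟨ *P-cong (prodP-factor D 1-X^ (geometric ∘ (2 ^_)) (S L)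
                                                         (λ p → ≋-sym ([1-x]*geometric (2 ^ p)))) (≋-refl {P₊}) ⟩
  (D ^P length (S L) *P G) *P P₊           ≈⟨ *P-assoc (D ^P length (S L)) G P₊ ⟩
  D ^P length (S L) *P (G *P P₊)           ∎)
  where
  open ≋-Reasoning
  D  = oneP -P X^ 1
  G  = prodP (map (geometric ∘ (2 ^_)) (S L))
  P₊ = prodP (map 1+X^ (notS L))

-- Power sums

∑< : ℕ → (ℕ → ℕ) → ℕ
∑< zero    f = 0
∑< (suc n) f = f 0 + ∑< n (f ∘ suc)

∑<-cong : ∀ n {f g} → (∀ i → i < n → f i ≡ g i) → ∑< n f ≡ ∑< n g
∑<-cong zero    f≡g = refl
∑<-cong (suc n) f≡g = cong₂ _+_ (f≡g 0 (s≤s z≤n)) (∑<-cong n (λ i i<n → f≡g (suc i) (s≤s i<n)))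

∑<-+ : ∀ n f g → ∑< n (λ i → f i + g i) ≡ ∑< n f + ∑< n g
∑<-+ zero    f g = refl
∑<-+ (suc n) f g = trans (cong (λ x → f 0 + g 0 + x) (∑<-+ n (f ∘ suc) (g ∘ suc)))
                         (+-+-interchange (f 0) (g 0) (∑< n (f ∘ suc)) (∑< n (g ∘ suc)))
  where
  +-+-interchange : ∀ a b c d → a + b + (c + d) ≡ a + c + (b + d)
  +-+-interchange = solve-∀

∑<-*ˡ : ∀ n a f → ∑< n (λ i → a * f i) ≡ a * ∑< n f
∑<-*ˡ zero    a f = sym (*-zeroʳ a)
∑<-*ˡ (suc n) a f = trans (cong (λ x → a * f 0 + x) (∑<-*ˡ n a (f ∘ suc))) (sym (*-distribˡ-+ a (f 0) _))

∑<-+-split : ∀ m n f → ∑< (m + n) f ≡ ∑< m f + ∑< n (λ i → f (m + i))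
∑<-+-split zero    n f = refl
∑<-+-split (suc m) n f = trans (cong (λ x → f 0 + x) (∑<-+-split m n (f ∘ suc))) (sym (+-assoc (f 0) _ _))

∑<ᵇ : ℕ → (ℕ → Bool) → (ℕ → ℕ) → ℕ
∑<ᵇ n c f = ∑< n (λ i → if c i then f i else 0)

sum-map-filterᵇ-applyUpTo : ∀ (f : ℕ → ℕ) c (g : ℕ → ℕ) n →
  sum (map f (filterᵇ c (applyUpTo g n))) ≡ ∑<ᵇ n (c ∘ g) (f ∘ g)
sum-map-filterᵇ-applyUpTo f c g zero = refl
sum-map-filterᵇ-applyUpTo f c g (suc n) with c (g 0)
... | true  = cong (λ x → f (g 0) + x) (sum-map-filterᵇ-applyUpTo f c (g ∘ suc) n)
... | false = sum-map-filterᵇ-applyUpTo f c (g ∘ suc) n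

∑<ᵇ-cong : ∀ n {c c′ f f′} → (∀ i → i < n → c i ≡ c′ i) → (∀ i → i < n → f i ≡ f′ i) →
           ∑<ᵇ n c f ≡ ∑<ᵇ n c′ f′
∑<ᵇ-cong n c≡c′ f≡f′ =
  ∑<-cong n λ i i<n → cong₂ (λ b x → if b then x else 0) (c≡c′ i i<n) (f≡f′ i i<n)

∑<ᵇ-+ : ∀ n c f g → ∑<ᵇ n c (λ i → f i + g i) ≡ ∑<ᵇ n c f + ∑<ᵇ n c g
∑<ᵇ-+ n c f g = trans (∑<-cong n (λ i _ → if-+ (c i))) (∑<-+ n _ _)
  where
  if-+ : ∀ b {x y} → (if b then x + y else 0) ≡ (if b then x else 0) + (if b then y else 0)
  if-+ true  = refl
  if-+ false = refl

∑<ᵇ-*ˡ : ∀ n c a f → ∑<ᵇ n c (λ i → a * f i) ≡ a * ∑<ᵇ n c f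
∑<ᵇ-*ˡ n c a f = trans (∑<-cong n (λ i _ → if-* (c i))) (∑<-*ˡ n a _)
  where
  if-* : ∀ b {x} → (if b then a * x else 0) ≡ a * (if b then x else 0)
  if-* true  = refl
  if-* false = sym (*-zeroʳ a)

∑<ᵇ-double : ∀ n c f → ∑<ᵇ (2 * n) c f ≡ ∑<ᵇ n c f + ∑<ᵇ n (λ i → c (n + i)) (λ i → f (n + i))
∑<ᵇ-double n c f = trans (cong (λ m → ∑<ᵇ (n + m) c f) (+-identityʳ n)) (∑<-+-split n n _)

infixl 6 _⊕_
infixr 7 _⊛_

data NatPoly : ℕ → Set where
  mono : ∀ {d} i → i ≤ d → NatPoly d
  _⊕_  : ∀ {d} → NatPoly d → NatPoly d → NatPoly d
  _⊛_  : ∀ {d} → ℕ → NatPoly d → NatPoly d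

⟦_⟧ : ∀ {d} → NatPoly d → ℕ → ℕ
⟦ mono i _ ⟧ n = n ^ i
⟦ f ⊕ g ⟧    n = ⟦ f ⟧ n + ⟦ g ⟧ n
⟦ a ⊛ f ⟧    n = a * ⟦ f ⟧ n

mul-c+x : ∀ {d} → ℕ → NatPoly d → NatPoly (suc d)
mul-c+x c (mono i i≤d) = c ⊛ mono i (m≤n⇒m≤1+n i≤d) ⊕ mono (suc i) (s≤s i≤d)
mul-c+x c (f ⊕ g)      = mul-c+x c f ⊕ mul-c+x c g
mul-c+x c (a ⊛ f)      = a ⊛ mul-c+x c f

⟦mul-c+x⟧ : ∀ {d} c (f : NatPoly d) n → ⟦ mul-c+x c f ⟧ n ≡ (c + n) * ⟦ f ⟧ n
⟦mul-c+x⟧ c (mono i _) n = sym (*-distribʳ-+ (n ^ i) c n)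
⟦mul-c+x⟧ c (f ⊕ g)    n =
  trans (cong₂ _+_ (⟦mul-c+x⟧ c f n) (⟦mul-c+x⟧ c g n)) (sym (*-distribˡ-+ (c + n) _ _))
⟦mul-c+x⟧ c (a ⊛ f)    n = trans (cong (a *_) (⟦mul-c+x⟧ c f n)) (x*[y*z]≡y*[x*z] a (c + n) (⟦ f ⟧ n))
  where
  x*[y*z]≡y*[x*z] : ∀ x y z → x * (y * z) ≡ y * (x * z)
  x*[y*z]≡y*[x*z] = solve-∀

[c+x]^ : ∀ c k → NatPoly k
[c+x]^ c zero    = mono 0 z≤n
[c+x]^ c (suc k) = mul-c+x c ([c+x]^ c k)

⟦[c+x]^⟧ : ∀ c k n → ⟦ [c+x]^ c k ⟧ n ≡ (c + n) ^ k
⟦[c+x]^⟧ c zero    n = refl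
⟦[c+x]^⟧ c (suc k) n = trans (⟦mul-c+x⟧ c ([c+x]^ c k) n) (cong ((c + n) *_) (⟦[c+x]^⟧ c k n))

[c+x]^1+-lower : ∀ c k → NatPoly k
[c+x]^1+-lower c zero    = c ⊛ mono 0 z≤n
[c+x]^1+-lower c (suc k) = c ⊛ mono (suc k) ≤-refl ⊕ mul-c+x c ([c+x]^1+-lower c k)

[c+x]^1+ : ∀ c k n → (c + n) ^ suc k ≡ n ^ suc k + ⟦ [c+x]^1+-lower c k ⟧ n
[c+x]^1+ c zero    n = e c n
  where
  e : ∀ c n → (c + n) * 1 ≡ n * 1 + c * 1
  e = solve-∀
[c+x]^1+ c (suc k) n = begin
  (c + n) * (c + n) ^ suc k
    ≡⟨ cong ((c + n) *_) ([c+x]^1+ c k n) ⟩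
  (c + n) * (n ^ suc k + R)
    ≡⟨ e c n (n ^ suc k) R ⟩
  n * n ^ suc k + (c * n ^ suc k + (c + n) * R)
    ≡⟨ cong (λ x → n * n ^ suc k + (c * n ^ suc k + x)) (⟦mul-c+x⟧ c ([c+x]^1+-lower c k) n) ⟨
  n * n ^ suc k + ⟦ [c+x]^1+-lower c (suc k) ⟧ n
    ∎
  where
  open ≡-Reasoning
  R = ⟦ [c+x]^1+-lower c k ⟧ n
  e : ∀ c n p r → (c + n) * (p + r) ≡ n * p + (c * p + (c + n) * r)
  e = solve-∀

-- Exponents k < K rather than k ≤ K − 1: then |S_L| itself is the bound, and Balanced 0 holds vacuously.
Balanced : ℕ → ℕ → (ℕ → Bool) → Set
Balanced K n c = ∀ k → k < K → ∑<ᵇ n c (_^ k) ≡ ∑<ᵇ n (not ∘ c) (_^ k)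

Balanced⇒NatPoly : ∀ {K} n c → Balanced K n c → ∀ {d} → d < K → (f : NatPoly d) →
                   ∑<ᵇ n c ⟦ f ⟧ ≡ ∑<ᵇ n (not ∘ c) ⟦ f ⟧
Balanced⇒NatPoly n c bal d<K (mono i i≤d) = bal i (≤-<-trans i≤d d<K)
Balanced⇒NatPoly n c bal d<K (f ⊕ g) = begin
  ∑<ᵇ n c ⟦ f ⊕ g ⟧
    ≡⟨ ∑<ᵇ-+ n c ⟦ f ⟧ ⟦ g ⟧ ⟩
  ∑<ᵇ n c ⟦ f ⟧ + ∑<ᵇ n c ⟦ g ⟧
    ≡⟨ cong₂ _+_ (Balanced⇒NatPoly n c bal d<K f) (Balanced⇒NatPoly n c bal d<K g) ⟩
  ∑<ᵇ n (not ∘ c) ⟦ f ⟧ + ∑<ᵇ n (not ∘ c) ⟦ g ⟧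
    ≡⟨ ∑<ᵇ-+ n (not ∘ c) ⟦ f ⟧ ⟦ g ⟧ ⟨
  ∑<ᵇ n (not ∘ c) ⟦ f ⊕ g ⟧
    ∎
  where open ≡-Reasoning
Balanced⇒NatPoly n c bal d<K (a ⊛ f) = begin
  ∑<ᵇ n c ⟦ a ⊛ f ⟧               ≡⟨ ∑<ᵇ-*ˡ n c a ⟦ f ⟧ ⟩
  a * ∑<ᵇ n c ⟦ f ⟧               ≡⟨ cong (a *_) (Balanced⇒NatPoly n c bal d<K f) ⟩
  a * ∑<ᵇ n (not ∘ c) ⟦ f ⟧       ≡⟨ ∑<ᵇ-*ˡ n (not ∘ c) a ⟦ f ⟧ ⟨
  ∑<ᵇ n (not ∘ c) ⟦ a ⊛ f ⟧       ∎
  where open ≡-Reasoning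

Balanced-double : ∀ {K n c} → (∀ i → i < n → c (n + i) ≡ c i) → Balanced K n c → Balanced K (2 * n) c
Balanced-double {K} {n} {c} periodic bal k k<K = begin
  ∑<ᵇ (2 * n) c (_^ k)
    ≡⟨ ∑<ᵇ-double n c (_^ k) ⟩
  ∑<ᵇ n c (_^ k) + ∑<ᵇ n (λ i → c (n + i)) (λ i → (n + i) ^ k)
    ≡⟨ cong₂ _+_ (bal k k<K) (∑<ᵇ-cong n periodic (λ i _ → sym (⟦[c+x]^⟧ n k i))) ⟩
  ∑<ᵇ n (not ∘ c) (_^ k) + ∑<ᵇ n c ⟦ [c+x]^ n k ⟧
    ≡⟨ cong (λ x → ∑<ᵇ n (not ∘ c) (_^ k) + x) (Balanced⇒NatPoly n c bal k<K ([c+x]^ n k)) ⟩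
  ∑<ᵇ n (not ∘ c) (_^ k) + ∑<ᵇ n (not ∘ c) ⟦ [c+x]^ n k ⟧
    ≡⟨ cong (λ x → ∑<ᵇ n (not ∘ c) (_^ k) + x)
            (∑<ᵇ-cong n (λ i i<n → cong not (sym (periodic i i<n))) (λ i _ → ⟦[c+x]^⟧ n k i)) ⟩
  ∑<ᵇ n (not ∘ c) (_^ k) + ∑<ᵇ n (λ i → not (c (n + i))) (λ i → (n + i) ^ k)
    ≡⟨ ∑<ᵇ-double n (not ∘ c) (_^ k) ⟨
  ∑<ᵇ (2 * n) (not ∘ c) (_^ k)
    ∎
  where open ≡-Reasoning

∑<ᵇ-[n+x]^1+ : ∀ n c k →
  ∑<ᵇ n c (λ i → (n + i) ^ suc k) ≡ ∑<ᵇ n c (_^ suc k) + ∑<ᵇ n c ⟦ [c+x]^1+-lower n k ⟧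
∑<ᵇ-[n+x]^1+ n c k =
  trans (∑<ᵇ-cong n (λ _ _ → refl) (λ i _ → [c+x]^1+ n k i)) (∑<ᵇ-+ n c (_^ suc k) ⟦ [c+x]^1+-lower n k ⟧)

Balanced-double-flip : ∀ {K n c} → (∀ i → i < n → c (n + i) ≡ not (c i)) →
                       Balanced K n c → Balanced (suc K) (2 * n) c
Balanced-double-flip {K} {n} {c} antiperiodic bal k k<1+K = begin
  ∑<ᵇ (2 * n) c (_^ k)
    ≡⟨ ∑<ᵇ-double n c (_^ k) ⟩
  ∑<ᵇ n c (_^ k) + ∑<ᵇ n (λ i → c (n + i)) (λ i → (n + i) ^ k)
    ≡⟨ cong (λ x → ∑<ᵇ n c (_^ k) + x) (∑<ᵇ-cong n antiperiodic (λ _ _ → refl)) ⟩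
  ∑<ᵇ n c (_^ k) + ∑<ᵇ n (not ∘ c) (λ i → (n + i) ^ k)
    ≡⟨ swap-halves k k<1+K ⟩
  ∑<ᵇ n (not ∘ c) (_^ k) + ∑<ᵇ n c (λ i → (n + i) ^ k)
    ≡⟨ cong (λ x → ∑<ᵇ n (not ∘ c) (_^ k) + x) (∑<ᵇ-cong n not-c≡c (λ _ _ → refl)) ⟩
  ∑<ᵇ n (not ∘ c) (_^ k) + ∑<ᵇ n (λ i → not (c (n + i))) (λ i → (n + i) ^ k)
    ≡⟨ ∑<ᵇ-double n (not ∘ c) (_^ k) ⟨
  ∑<ᵇ (2 * n) (not ∘ c) (_^ k)
    ∎
  where
  open ≡-Reasoning
  not-c≡c : ∀ i → i < n → c i ≡ not (c (n + i))
  not-c≡c i i<n = trans (sym (not-involutive (c i))) (cong not (sym (antiperiodic i i<n)))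
  x+[y+z]≡y+[x+z] : ∀ x y z → x + (y + z) ≡ y + (x + z)
  x+[y+z]≡y+[x+z] = solve-∀
  swap-halves : ∀ k → k < suc K →
    ∑<ᵇ n c (_^ k) + ∑<ᵇ n (not ∘ c) (λ i → (n + i) ^ k) ≡
    ∑<ᵇ n (not ∘ c) (_^ k) + ∑<ᵇ n c (λ i → (n + i) ^ k)
  swap-halves zero    _         = +-comm (∑<ᵇ n c (_^ 0)) (∑<ᵇ n (not ∘ c) (_^ 0))
  swap-halves (suc k) (s≤s k<K) = begin
    A c + ∑<ᵇ n (not ∘ c) (λ i → (n + i) ^ suc k)  ≡⟨ cong (λ x → A c + x) (∑<ᵇ-[n+x]^1+ n (not ∘ c) k) ⟩
    A c + (A (not ∘ c) + R (not ∘ c))             ≡⟨ cong (λ x → A c + (A (not ∘ c) + x))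
                                                         (Balanced⇒NatPoly n c bal k<K ([c+x]^1+-lower n k)) ⟨
    A c + (A (not ∘ c) + R c)                     ≡⟨ x+[y+z]≡y+[x+z] (A c) (A (not ∘ c)) (R c) ⟩
    A (not ∘ c) + (A c + R c)                     ≡⟨ cong (λ x → A (not ∘ c) + x) (∑<ᵇ-[n+x]^1+ n c k) ⟨
    A (not ∘ c) + ∑<ᵇ n c (λ i → (n + i) ^ suc k) ∎
    where
    A R : (ℕ → Bool) → ℕ
    A c′ = ∑<ᵇ n c′ (_^ suc k)
    R c′ = ∑<ᵇ n c′ ⟦ [c+x]^1+-lower n k ⟧

inClass0 : ℕ → Bool
inClass0 n = M₂ n ≡ᵇ 0

[1∸v]≡ᵇ0 : ∀ {v} → v ≤ 1 → (1 ∸ v ≡ᵇ 0) ≡ not (v ≡ᵇ 0)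
[1∸v]≡ᵇ0 z≤n       = refl
[1∸v]≡ᵇ0 (s≤s z≤n) = refl

M₂-balanced : ∀ L → Balanced (length (S L)) (2 ^ L) inClass0
M₂-balanced zero = λ k ()
M₂-balanced (suc L) with inSᵇ L in inS | M₂-shift L
... | true | shift =
  subst (λ K → Balanced K (2 ^ suc L) inClass0) (sym (length-S-accept L inS))
        (Balanced-double-flip (λ i i< → trans (cong (_≡ᵇ 0) (shift i i<)) ([1∸v]≡ᵇ0 (M₂≤1 i)))
                              (M₂-balanced L))
... | false | shift =
  subst (λ K → Balanced K (2 ^ suc L) inClass0) (sym (length-S-reject L inS))
        (Balanced-double (λ i i< → cong (_≡ᵇ 0) (shift i i<)) (M₂-balanced L))

M₂-PTE : ∀ L → 1 ≤ L → IsPTE (length (S L) ∸ 1) (class0 (2 ^ L)) (class1 (2 ^ L))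
-- 0 ∈ S, so length (S (suc L)) reduces to a successor and k ≤ |S| ∸ 1 is k < |S|.
M₂-PTE (suc L) _ k k≤D = begin
  powerSum k (class0 (2 ^ suc L))
    ≡⟨ sum-map-filterᵇ-applyUpTo (_^ k) inClass0 (λ n → n) (2 ^ suc L) ⟩
  ∑<ᵇ (2 ^ suc L) inClass0 (_^ k)
    ≡⟨ M₂-balanced (suc L) k (s≤s k≤D) ⟩
  ∑<ᵇ (2 ^ suc L) (not ∘ inClass0) (_^ k)
    ≡⟨ sum-map-filterᵇ-applyUpTo (_^ k) (not ∘ inClass0) (λ n → n) (2 ^ suc L) ⟨
  powerSum k (class1 (2 ^ suc L))
    ∎
  where open ≡-Reasoning

proposition60 : (L : ℕ) → 1 ≤ L →
    (F L ≈P prodP (map (λ p → oneP -P X^ (2 ^ p)) (S L))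
            *P prodP (map (λ p → oneP +P X^ (2 ^ p)) (notS L)))
  × ((oneP -P X^ 1) ^P length (S L) ∣P F L)
  × IsPTE (length (S L) ∸ 1) (class0 (2 ^ L)) (class1 (2 ^ L))
  × ((q r : ℕ) → r < 6 → L ≡ 6 * q + r →
       length (S L) ≡ L ∸ (2 * q + ind345 r))
proposition60 L 1≤L =
    coeff-≡ (F≋Prod L)
  , [1-x]^|S|∣F L
  , M₂-PTE L 1≤L
  , λ { q r r<6 refl → length-S q r r<6 }
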